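{- Let $p$ be a prime with $p\equiv 1\pmod 4$. If $d,u,v$ are positive integers with $\frac{4}{p}=\frac{1}{du}+\frac{1}{dv}+\frac{1}{duv}$, then $d\le \left\lfloor \frac{p+3}{8}\right\rfloor$. This bound is optimal: there exist such primes (for example $p=13$) having a solution of this form with $d=\left\lfloor \frac{p+3}{8}\right\rfloor$. -}

module Defs where

open import Data.Nat using (ℕ; zero; suc)
open import Data.Integer using (+_)
open import Data.Rational using (ℚ; _/_; 0ℚ)

-- The rational number a / n for a natural number n ≥ 1.
-- (Only ever applied to positive n in the statement; the value at n = 0 is an
-- irrelevant junk value 0.)
frac : ℕ → ℕ → ℚ
frac a zero    = 0ℚ
frac a (suc n) = + a / suc n

{-# OPTIONS --safe #-}
-- Clearing denominators turns 4/p = 1/(du) + 1/(dv) + 1/(duv) into 4duv = p(u + v + 1).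
-- The prime p ≡ 1 (mod 4) does not divide 4, so it divides d, u or v. It cannot divide d,
-- since 4duv > u + v + 1. If, say, u = kp, cancelling p leaves 4dkv = kp + v + 1: for v = 1
-- this forces k ∣ 2, and both k = 1 and k = 2 contradict p ≡ 1 (mod 4); for v ≥ 2 it gives
-- 8dkv = 2(kp + v + 1) ≤ (p + 3)kv.
module Submission where

open import Defs
open import Data.Integer using (+_)
import Data.Integer as ℤ
open import Data.Integer.Properties using (pos-+; pos-*)
open import Data.List using (_∷_; [])
open import Data.Nat using (ℕ; suc; _+_; _*_; _≤_; _<_; _/_; _%_; NonZero; >-nonZero; z<s; s≤s; z≤n)
open import Data.Nat.DivMod using (%-distribˡ-+; m*n%n≡0; m*n/n≡m; /-monoˡ-≤)
open import Data.Nat.Divisibility using (_∣_; divides; divides-refl; ∣⇒≤; ∣m+n∣m⇒∣n; m∣m*n)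
open import Data.Nat.Primality using (Prime; euclidsLemma; ¬prime[1]; prime⇒nonZero; prime?)
open import Data.Nat.Properties
  using (m*n≢0; m*n≢0⇒m≢0; *-comm; *-cancelʳ-≡; *-cancelˡ-≡; *-cancelʳ-≤; <⇒≢; m≤m+n; m<m+n; module ≤-Reasoning)
open import Data.Nat.Tactic.RingSolver using (solve-∀; solve)
open import Data.Product using (_×_; _,_; ∃-syntax)
open import Data.Rational using (fromℚᵘ; toℚᵘ) renaming (_+_ to _+q_)
open import Data.Rational.Properties
  using (normalize-injective-≃; fromℚᵘ-cong; fromℚᵘ-toℚᵘ; toℚᵘ-fromℚᵘ; toℚᵘ-homo-+)
import Data.Rational.Unnormalised as ℚᵘ
import Data.Rational.Unnormalised.Properties as ℚᵘ
open import Data.Sum using (_⊎_; inj₁; inj₂; [_,_]′; map₂)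
open import Function using (id)
open import Relation.Binary.PropositionalEquality
  using (_≡_; refl; sym; trans; cong; cong₂; subst; module ≡-Reasoning)
open import Relation.Nullary using (¬_; contradiction)
open import Relation.Nullary.Decidable using (from-yes)

frac-≡⇒*≡* : ∀ a b m n .{{_ : NonZero m}} .{{_ : NonZero n}} →
                 frac a m ≡ frac b n → a * n ≡ b * m
frac-≡⇒*≡* a b (suc m) (suc n) = normalize-injective-≃ a b (suc m) (suc n)

*≡*⇒frac-≡ : ∀ a b m n .{{_ : NonZero m}} .{{_ : NonZero n}} →
            a * n ≡ b * m → frac a m ≡ frac b n
*≡*⇒frac-≡ a b (suc m) (suc n) eq =
  fromℚᵘ-cong {ℚᵘ.mkℚᵘ (+ a) m} {ℚᵘ.mkℚᵘ (+ b) n} (ℚᵘ.*≡* (begin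
    + a ℤ.* + suc n   ≡⟨ pos-* a (suc n) ⟨
    + (a * suc n)     ≡⟨ cong +_ eq ⟩
    + (b * suc m)     ≡⟨ pos-* b (suc m) ⟩
    + b ℤ.* + suc m   ∎))
  where open ≡-Reasoning

frac-+ : ∀ a b m n .{{_ : NonZero m}} .{{_ : NonZero n}} →
         frac a m +q frac b n ≡ frac (a * n + b * m) (m * n)
frac-+ a b m@(suc m-1) n@(suc n-1) = begin
  frac a m +q frac b n                  ≡⟨ fromℚᵘ-toℚᵘ _ ⟨
  fromℚᵘ (toℚᵘ (frac a m +q frac b n))  ≡⟨ fromℚᵘ-cong toℚᵘ-sum ⟩
  fromℚᵘ (A ℚᵘ.+ B)                     ≡⟨ cong (λ c → fromℚᵘ (ℚᵘ.mkℚᵘ c _)) numerator ⟨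
  frac (a * n + b * m) (m * n)          ∎
  where
  open ≡-Reasoning
  A = ℚᵘ.mkℚᵘ (+ a) m-1
  B = ℚᵘ.mkℚᵘ (+ b) n-1
  toℚᵘ-sum : toℚᵘ (frac a m +q frac b n) ℚᵘ.≃ A ℚᵘ.+ B
  toℚᵘ-sum = ℚᵘ.≃-trans (toℚᵘ-homo-+ (frac a m) (frac b n))
                        (ℚᵘ.+-cong (toℚᵘ-fromℚᵘ A) (toℚᵘ-fromℚᵘ B))
  numerator : + (a * n + b * m) ≡ + a ℤ.* + n ℤ.+ + b ℤ.* + m
  numerator = trans (pos-+ (a * n) (b * m)) (cong₂ ℤ._+_ (pos-* a n) (pos-* b m))

frac-+-sameDenominator : ∀ a b n .{{_ : NonZero n}} →
                         frac a n +q frac b n ≡ frac (a + b) n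
frac-+-sameDenominator a b n =
  trans (frac-+ a b n n) (*≡*⇒frac-≡ _ _ (n * n) n {{m*n≢0 n n}} (cross a b n))
  where
  cross : ∀ a b n → (a * n + b * n) * n ≡ (a + b) * (n * n)
  cross = solve-∀

unitFractions-sum : ∀ d u v .{{_ : NonZero d}} .{{_ : NonZero u}} .{{_ : NonZero v}} →
  frac 1 (d * u) +q frac 1 (d * v) +q frac 1 (d * u * v) ≡ frac (v + u + 1) (d * u * v)
unitFractions-sum d u v = begin
  frac 1 (d * u) +q frac 1 (d * v) +q frac 1 N
    ≡⟨ cong₂ (λ x y → x +q y +q frac 1 N)
             (*≡*⇒frac-≡ 1 v (d * u) (d * u * v) (solve (d ∷ u ∷ v ∷ [])))
             (*≡*⇒frac-≡ 1 u (d * v) (d * u * v) (solve (d ∷ u ∷ v ∷ []))) ⟩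
  frac v N +q frac u N +q frac 1 N
    ≡⟨ cong (_+q frac 1 N) (frac-+-sameDenominator v u N) ⟩
  frac (v + u) N +q frac 1 N
    ≡⟨ frac-+-sameDenominator (v + u) 1 N ⟩
  frac (v + u + 1) N ∎
  where
  open ≡-Reasoning
  N = d * u * v
  instance
    du≢0  = m*n≢0 d u
    dv≢0  = m*n≢0 d v
    duv≢0 = m*n≢0 (d * u) v

egyptian⇒diophantine : ∀ n p d u v .{{_ : NonZero p}}
                       .{{_ : NonZero d}} .{{_ : NonZero u}} .{{_ : NonZero v}} →
  frac n p ≡ frac 1 (d * u) +q frac 1 (d * v) +q frac 1 (d * u * v) →
  n * (d * u * v) ≡ (v + u + 1) * p
egyptian⇒diophantine n p d u v eq =
  frac-≡⇒*≡* n (v + u + 1) p (d * u * v) (trans eq (unitFractions-sum d u v))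
  where instance _ = m*n≢0 (d * u) v {{m*n≢0 d u}}

p%4≡1⇒p∤4 : ∀ {p} → Prime p → p % 4 ≡ 1 → ¬ p ∣ 4
p%4≡1⇒p∤4 {1} 1-prime _ _ = ¬prime[1] 1-prime
p%4≡1⇒p∤4 {suc (suc (suc (suc (suc _))))} _ _ p∣4 =
  contradiction (∣⇒≤ p∣4) λ { (s≤s (s≤s (s≤s (s≤s ())))) }

4*d≡p+r⇒[1+r]%4≡0 : ∀ {p} d r → p % 4 ≡ 1 → 4 * d ≡ p + r → (1 + r) % 4 ≡ 0
4*d≡p+r⇒[1+r]%4≡0 {p} d r p%4≡1 eq = begin
  (1 + r) % 4          ≡⟨ %-distribˡ-+ 1 r 4 ⟩
  (1 + r % 4) % 4      ≡⟨ cong (λ x → (x + r % 4) % 4) p%4≡1 ⟨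
  (p % 4 + r % 4) % 4  ≡⟨ %-distribˡ-+ p r 4 ⟨
  (p + r) % 4          ≡⟨ cong (_% 4) eq ⟨
  (4 * d) % 4          ≡⟨ cong (_% 4) (*-comm 4 d) ⟩
  (d * 4) % 4          ≡⟨ m*n%n≡0 d 4 ⟩
  0                    ∎
  where open ≡-Reasoning

v+u+1<4*[k*u*v] : ∀ k u v .{{_ : NonZero k}} .{{_ : NonZero u}} .{{_ : NonZero v}} →
                  v + u + 1 < 4 * (k * u * v)
v+u+1<4*[k*u*v] (suc k) (suc u) (suc v) = begin-strict
  suc v + suc u + 1
    <⟨ m<m+n _ z<s ⟩
  suc v + suc u + 1 + suc (3 * u + 3 * v + 4 * u * v + 4 * k * suc u * suc v)
    ≡⟨ solve (k ∷ u ∷ v ∷ []) ⟩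
  4 * (suc k * suc u * suc v) ∎
  where open ≤-Reasoning

reduced-equation-with-w≡1⇒k∣2 : ∀ {p} d k → 4 * (d * k * 1) ≡ k * p + 2 → k ∣ 2
reduced-equation-with-w≡1⇒k∣2 {p} d k eq =
  ∣m+n∣m⇒∣n (divides (4 * d) (trans (sym eq) (solve (d ∷ k ∷ [])))) (m∣m*n p)

reduced-equation-with-w≡1-unsolvable : ∀ {p} d k .{{_ : NonZero k}} → p % 4 ≡ 1 →
                                       ¬ 4 * (d * k * 1) ≡ k * p + 2
reduced-equation-with-w≡1-unsolvable {p} d 1 p%4≡1 eq =
  contradiction (4*d≡p+r⇒[1+r]%4≡0 d 2 p%4≡1 (begin
    4 * d            ≡⟨ solve (d ∷ []) ⟩
    4 * (d * 1 * 1)  ≡⟨ eq ⟩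
    1 * p + 2        ≡⟨ solve (p ∷ []) ⟩
    p + 2            ∎)) λ ()
  where open ≡-Reasoning
reduced-equation-with-w≡1-unsolvable {p} d 2 p%4≡1 eq =
  contradiction (4*d≡p+r⇒[1+r]%4≡0 d 1 p%4≡1 (*-cancelˡ-≡ (4 * d) (p + 1) 2 (begin
    2 * (4 * d)      ≡⟨ solve (d ∷ []) ⟩
    4 * (d * 2 * 1)  ≡⟨ eq ⟩
    2 * p + 2        ≡⟨ solve (p ∷ []) ⟩
    2 * (p + 1)      ∎))) λ ()
  where open ≡-Reasoning
reduced-equation-with-w≡1-unsolvable {p} d k@(suc (suc (suc _))) _ eq =
  contradiction (∣⇒≤ (reduced-equation-with-w≡1⇒k∣2 {p} d k eq)) λ { (s≤s (s≤s ())) }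

2*[k*p+[w+1]]≤[p+3]*[k*w] : ∀ p k w .{{_ : NonZero k}} → 2 ≤ w →
                          2 * (k * p + (w + 1)) ≤ (p + 3) * (k * w)
2*[k*p+[w+1]]≤[p+3]*[k*w] p (suc k) w@(suc (suc w-2)) (s≤s (s≤s _)) = begin
  2 * (suc k * p + (w + 1))                                       ≤⟨ m≤m+n _ _ ⟩
  2 * (suc k * p + (w + 1)) + (suc k * p * w-2 + 3 * k * w + w-2)  ≡⟨ solve (p ∷ k ∷ w-2 ∷ []) ⟩
  (p + 3) * (suc k * w)                                           ∎
  where open ≤-Reasoning

reduced-equation⇒8d≤p+3 : ∀ {p} d k w .{{_ : NonZero k}} .{{_ : NonZero w}} → p % 4 ≡ 1 →
                          4 * (d * k * w) ≡ k * p + (w + 1) → 8 * d ≤ p + 3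
reduced-equation⇒8d≤p+3 d k 1 p%4≡1 eq =
  contradiction eq (reduced-equation-with-w≡1-unsolvable d k p%4≡1)
reduced-equation⇒8d≤p+3 {p} d k w@(suc (suc w-2)) _ eq =
  *-cancelʳ-≤ (8 * d) (p + 3) (k * w) {{m*n≢0 k w}} (begin
    8 * d * (k * w)        ≡⟨ solve (d ∷ k ∷ w-2 ∷ []) ⟩
    2 * (4 * (d * k * w))  ≡⟨ cong (2 *_) eq ⟩
    2 * (k * p + (w + 1))  ≤⟨ 2*[k*p+[w+1]]≤[p+3]*[k*w] p k w (s≤s (s≤s z≤n)) ⟩
    (p + 3) * (k * w)      ∎)
  where open ≤-Reasoning

p∤d : ∀ {p} d u v .{{_ : NonZero p}} .{{_ : NonZero d}} .{{_ : NonZero u}} .{{_ : NonZero v}} →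
      4 * (d * u * v) ≡ (v + u + 1) * p → ¬ p ∣ d
p∤d {p} .(k * p) u v eq (divides-refl k) =
  <⇒≢ (v+u+1<4*[k*u*v] k u v {{m*n≢0⇒m≢0 k}}) (sym (*-cancelʳ-≡ _ _ p (begin
    4 * (k * u * v) * p  ≡⟨ solve (k ∷ u ∷ v ∷ p ∷ []) ⟩
    4 * (k * p * u * v)  ≡⟨ eq ⟩
    (v + u + 1) * p      ∎)))
  where open ≡-Reasoning

p∣u⇒8d≤p+3 : ∀ {p} d u v .{{_ : NonZero p}} .{{_ : NonZero u}} .{{_ : NonZero v}} → p % 4 ≡ 1 →
             4 * (d * u * v) ≡ (v + u + 1) * p → p ∣ u → 8 * d ≤ p + 3
p∣u⇒8d≤p+3 {p} d .(k * p) v p%4≡1 eq (divides-refl k) =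
  reduced-equation⇒8d≤p+3 d k v {{m*n≢0⇒m≢0 k}} p%4≡1 (*-cancelʳ-≡ _ _ p (begin
    4 * (d * k * v) * p    ≡⟨ solve (d ∷ k ∷ v ∷ p ∷ []) ⟩
    4 * (d * (k * p) * v)  ≡⟨ eq ⟩
    (v + k * p + 1) * p    ≡⟨ solve (k ∷ v ∷ p ∷ []) ⟩
    (k * p + (v + 1)) * p  ∎))
  where open ≡-Reasoning

prime∣m*n*o : ∀ {p} m n o → Prime p → p ∣ m * n * o → p ∣ m ⊎ p ∣ n ⊎ p ∣ o
prime∣m*n*o m n o p-prime p∣mno with euclidsLemma (m * n) o p-prime p∣mno
... | inj₁ p∣mn = map₂ inj₁ (euclidsLemma m n p-prime p∣mn)
... | inj₂ p∣o  = inj₂ (inj₂ p∣o)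

diophantine⇒8d≤p+3 : ∀ {p} d u v .{{_ : NonZero d}} .{{_ : NonZero u}} .{{_ : NonZero v}} →
                     Prime p → p % 4 ≡ 1 → 4 * (d * u * v) ≡ (v + u + 1) * p → 8 * d ≤ p + 3
diophantine⇒8d≤p+3 {p} d u v p-prime p%4≡1 eq =
  [ (λ p∣d → contradiction p∣d (p∤d d u v eq))
  , [ p∣u⇒8d≤p+3 d u v p%4≡1 eq
    , p∣u⇒8d≤p+3 d v u p%4≡1 eq[u↔v] ]′ ]′
  (prime∣m*n*o d u v p-prime p∣duv)
  where
  open ≡-Reasoning
  instance _ = prime⇒nonZero p-prime
  p∣duv : p ∣ d * u * v
  p∣duv = [ (λ p∣4 → contradiction p∣4 (p%4≡1⇒p∤4 p-prime p%4≡1)) , id ]′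
            (euclidsLemma 4 (d * u * v) p-prime (divides (v + u + 1) eq))
  eq[u↔v] : 4 * (d * v * u) ≡ (u + v + 1) * p
  eq[u↔v] = begin
    4 * (d * v * u)  ≡⟨ solve (d ∷ u ∷ v ∷ []) ⟩
    4 * (d * u * v)  ≡⟨ eq ⟩
    (v + u + 1) * p  ≡⟨ solve (u ∷ v ∷ p ∷ []) ⟩
    (u + v + 1) * p  ∎

n*m≤o⇒m≤o/n : ∀ m n o .{{_ : NonZero n}} → n * m ≤ o → m ≤ o / n
n*m≤o⇒m≤o/n m n o n*m≤o =
  subst (_≤ o / n) (m*n/n≡m m n) (/-monoˡ-≤ n (subst (_≤ o) (*-comm n m) n*m≤o))

proposition1 : ((p d u v : ℕ) → Prime p → p % 4 ≡ 1 → 0 < d → 0 < u → 0 < v →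
    frac 4 p ≡ frac 1 (d * u) +q frac 1 (d * v) +q frac 1 (d * u * v) →
    d ≤ (p + 3) / 8)
    ×
    (∃[ p ] ∃[ d ] ∃[ u ] ∃[ v ] (Prime p × p % 4 ≡ 1 × 0 < d × 0 < u × 0 < v ×
    frac 4 p ≡ frac 1 (d * u) +q frac 1 (d * v) +q frac 1 (d * u * v) ×
    d ≡ (p + 3) / 8))
proposition1 =
  (λ p d u v p-prime p%4≡1 d>0 u>0 v>0 eq →
    let instance
          _ = prime⇒nonZero p-prime
          _ = >-nonZero d>0
          _ = >-nonZero u>0
          _ = >-nonZero v>0
    in n*m≤o⇒m≤o/n d 8 (p + 3)
         (diophantine⇒8d≤p+3 d u v p-prime p%4≡1
           (egyptian⇒diophantine 4 p d u v eq)))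
  , (13 , 2 , 13 , 2 , from-yes (prime? 13) , refl , z<s , z<s , z<s , refl , refl)
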